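{- Let $f$ be a real polynomial in $x_1,\ldots,x_n$ all of whose coefficients are in $\{0,1\}$, and let $\mathcal{M}$ be the (nonempty) set of monomials occurring in $f$. Then for every $k$, $$\dim\partial^{=k} f\ \ge\ \frac{\sum_{P\in\mathcal{M}}\binom{\sup(P)}{k}}{|\mathcal{M}|^2}.$$
   Context: $\partial^{=k} f$ denotes the linear space spanned by all partial derivatives of $f$ of order $k$. For a monomial $P$, $\sup(P)$ is the number of distinct variables occurring in $P$. Coefficients are taken with respect to the scaled monomial basis $x^\alpha=x_1^{\alpha_1}\cdots x_n^{\alpha_n}/(\alpha_1!\cdots\alpha_n!)$, i.e., $f=\sum_{\alpha\in\mathcal{M}} x^\alpha$ with $\mathcal M$ identified with a set of exponent vectors.
   Formalization: The coefficient field is ℚ rather than ℝ, both for the polynomial f and for the linear space $\partial^{=k} f$ whose dimension is bounded. -}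

module Defs where

open import Data.Nat using (ℕ; zero; suc; _≟_)
open import Data.Nat.Combinatorics using (_C_)
open import Data.Bool using (if_then_else_)
open import Data.Fin using (Fin)
import Data.Fin as F
open import Data.Vec using (Vec; []; _∷_; updateAt; count)
open import Data.Vec.Properties using (≡-dec)
open import Data.Rational using (ℚ; 0ℚ; 1ℚ; _+_; _*_)
open import Data.List using (List)
open import Data.Product using (Σ; _×_)
open import Relation.Nullary using (¬_; does)
open import Relation.Nullary.Decidable using (¬?)
open import Relation.Binary.PropositionalEquality using (_≡_)
import Data.List.Membership.DecPropositional as DecMem

Exp : ℕ → Set
Exp n = Vec ℕ n

-- A polynomial in x₁..xₙ, given by its coefficients w.r.t. the scaled
-- monomial basis x^α = x₁^α₁⋯xₙ^αₙ/(α₁!⋯αₙ!).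
-- (Only finitely supported ones arise below.)
Poly : ℕ → Set
Poly n = Exp n → ℚ

polyOf : ∀ {n} → List (Exp n) → Poly n
polyOf {n} M α = if does (α ∈? M) then 1ℚ else 0ℚ
  where open DecMem (≡-dec _≟_)

-- ∂/∂x_i in the scaled basis: ∂_i x^α = x^(α - e_i), i.e.
-- coefficient of x^γ in ∂_i p is the coefficient of x^(γ + e_i) in p.
∂ : ∀ {n} → Fin n → Poly n → Poly n
∂ i p γ = p (updateAt γ i suc)

∂seq : ∀ {n k} → Vec (Fin n) k → Poly n → Poly n
∂seq []       p = p
∂seq (i ∷ is) p = ∂ i (∂seq is p)

Σℚ : ∀ {r} → (Fin r → ℚ) → ℚ
Σℚ {zero}  f = 0ℚ
Σℚ {suc r} f = f F.zero + Σℚ (λ j → f (F.suc j))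

LinIndep : ∀ {n r} → (Fin r → Poly n) → Set
LinIndep {n} {r} ps =
  (c : Fin r → ℚ) → (∀ γ → Σℚ (λ j → c j * ps j γ) ≡ 0ℚ) → ∀ j → c j ≡ 0ℚ

-- "dim ∂^{=k} f ≥ r": the span of all order-k partial derivatives of f
-- contains r linearly independent order-k partial derivatives of f.
DimDerivs≥ : (n k : ℕ) → Poly n → ℕ → Set
DimDerivs≥ n k f r =
  Σ (Fin r → Vec (Fin n) k) λ D → LinIndep (λ j → ∂seq (D j) f)

sup : ∀ {n} → Exp n → ℕ
sup α = count (λ a → ¬? (a ≟ 0)) α

module Submission where

-- Take a monomial P₀ ∈ M maximising C(sup P₀, k), and the C(sup P₀, k) multilinear derivatives
-- ∂^D for D ⊆ supp P₀ with |D| = k.  Each sends P₀ to the monomial Q_D = P₀ − D, so ∂^D f has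
-- coefficient 1 at Q_D.  Conversely ∂^{D'} f has a nonzero coefficient at Q_D only when
-- Q_D + D' ∈ M, and since D' ↦ Q_D + D' is injective this happens for at most |M| of the D'.
-- Greedily keeping some D and discarding the D' with Q_D + D' ∈ M therefore yields a triangular,
-- hence linearly independent, family of at least C(sup P₀, k)/|M| derivatives; and the sum in
-- the theorem is at most |M| · C(sup P₀, k).

open import Defs
open import Data.Nat using (ℕ; zero; suc; _+_; _∸_; _*_; _≤_; z≤n; s≤s; _≟_)
open import Data.Nat.Properties
  using (+-identityʳ; +-suc; +-comm; +-cancelˡ-≡; m∸n+n≡m; ≤-refl; ≤-trans; ≤-reflexive;
         +-mono-≤; *-monoʳ-≤; *-assoc; *-comm; ≤-totalOrder; module ≤-Reasoning)
open import Data.Nat.Combinatorics using (_C_; nCk+nC[k+1]≡[n+1]C[k+1])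
open import Data.Nat.ListAction using (sum)
open import Data.Fin using (Fin)
import Data.Fin as Fin
open import Data.Vec as Vec using (Vec; []; _∷_; updateAt; zipWith; replicate)
open import Data.Vec.Properties using (zipWith-identityʳ; ∷-injectiveˡ; ∷-injectiveʳ; ≡-dec)
open import Data.Vec.Relation.Binary.Pointwise.Inductive using (Pointwise; []; _∷_)
open import Data.List using (List; []; _∷_; _++_; map; length; filter; lookup)
open import Data.List.Properties using (length-map; length-++; length-filter)
open import Data.List.Relation.Unary.All as All using (All; []; _∷_)
import Data.List.Relation.Unary.All.Properties as All
open import Data.List.Relation.Unary.AllPairs as AllPairs using (AllPairs; []; _∷_)
import Data.List.Relation.Unary.AllPairs.Properties as AllPairs
open import Data.List.Relation.Unary.Any using (here; there)
open import Data.List.Relation.Unary.Unique.Propositional using (Unique)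
open import Data.List.Membership.Propositional using (_∈_; _∉_)
open import Data.List.Membership.Propositional.Properties using (∈-∃++; ∈-filter⁻; ∈-lookup)
import Data.List.Membership.DecPropositional as DecMembership
open import Data.List.Extrema ≤-totalOrder using (argmax; argmax-all; f[⊥]≤f[argmax]; f[xs]≤f[argmax])
open import Data.Rational using (ℚ; 0ℚ; 1ℚ) renaming (_+_ to _+ℚ_; _*_ to _*ℚ_)
import Data.Rational.Properties as ℚ
open import Data.Product using (Σ; _×_; _,_; proj₁; proj₂)
open import Data.Empty using (⊥-elim)
open import Data.Bool using (if_then_else_)
open import Relation.Nullary using (¬_; yes; no)
open import Relation.Nullary.Decidable using (¬?; dec-true; dec-false)
open import Relation.Unary using (Decidable)
open import Relation.Binary.Definitions using (DecidableEquality)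
open import Relation.Binary.PropositionalEquality
open import Function using (_∘_)

private
  variable
    n k : ℕ

infixl 6 _⊕_ _⊖_

_⊕_ _⊖_ : Vec ℕ n → Vec ℕ n → Vec ℕ n
_⊕_ = zipWith _+_
_⊖_ = zipWith _∸_

_≤ᵥ_ : Vec ℕ n → Vec ℕ n → Set
_≤ᵥ_ = Pointwise _≤_

⊕-identityʳ : (α : Vec ℕ n) → α ⊕ replicate n 0 ≡ α
⊕-identityʳ = zipWith-identityʳ +-identityʳ

updateAt-suc-⊕ : (α β : Vec ℕ n) (i : Fin n) → updateAt α i suc ⊕ β ≡ α ⊕ updateAt β i suc
updateAt-suc-⊕ (a ∷ α) (b ∷ β) Fin.zero    = cong (_∷ α ⊕ β) (sym (+-suc a b))
updateAt-suc-⊕ (a ∷ α) (b ∷ β) (Fin.suc i) = cong (a + b ∷_) (updateAt-suc-⊕ α β i)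

⊖-⊕-cancel : {α β : Vec ℕ n} → β ≤ᵥ α → α ⊖ β ⊕ β ≡ α
⊖-⊕-cancel []            = refl
⊖-⊕-cancel (b≤a ∷ β≤ᵥα) = cong₂ _∷_ (m∸n+n≡m b≤a) (⊖-⊕-cancel β≤ᵥα)

⊕-cancelˡ : (γ α β : Vec ℕ n) → γ ⊕ α ≡ γ ⊕ β → α ≡ β
⊕-cancelˡ []      []      []      _ = refl
⊕-cancelˡ (c ∷ γ) (a ∷ α) (b ∷ β) e =
  cong₂ _∷_ (+-cancelˡ-≡ c a b (∷-injectiveˡ e)) (⊕-cancelˡ γ α β (∷-injectiveʳ e))

0ᵥ≤ᵥ : (α : Vec ℕ n) → replicate n 0 ≤ᵥ α
0ᵥ≤ᵥ []      = []
0ᵥ≤ᵥ (_ ∷ α) = z≤n ∷ 0ᵥ≤ᵥ α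

multiplicity : Vec (Fin n) k → Vec ℕ n
multiplicity []      = replicate _ 0
multiplicity (i ∷ D) = updateAt (multiplicity D) i suc

∂seq-shift : (D : Vec (Fin n) k) (p : Poly n) (γ : Exp n) → ∂seq D p γ ≡ p (γ ⊕ multiplicity D)
∂seq-shift []      p γ = cong p (sym (⊕-identityʳ γ))
∂seq-shift (i ∷ D) p γ = begin
  ∂seq D p (updateAt γ i suc)                ≡⟨ ∂seq-shift D p (updateAt γ i suc) ⟩
  p (updateAt γ i suc ⊕ multiplicity D)      ≡⟨ cong p (updateAt-suc-⊕ γ (multiplicity D) i) ⟩
  p (γ ⊕ updateAt (multiplicity D) i suc)    ∎
  where open ≡-Reasoning

_≢ᵐ_ : Vec (Fin n) k → Vec (Fin n) k → Set
D ≢ᵐ D′ = multiplicity D ≢ multiplicity D′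

skip₀ : Vec (Fin n) k → Vec (Fin (suc n)) k
skip₀ = Vec.map Fin.suc

use₀ : Vec (Fin n) k → Vec (Fin (suc n)) (suc k)
use₀ D = Fin.zero ∷ skip₀ D

multiplicity-skip₀ : (D : Vec (Fin n) k) → multiplicity (skip₀ D) ≡ 0 ∷ multiplicity D
multiplicity-skip₀ []      = refl
multiplicity-skip₀ (i ∷ D) = cong (λ α → updateAt α (Fin.suc i) suc) (multiplicity-skip₀ D)

multiplicity-use₀ : (D : Vec (Fin n) k) → multiplicity (use₀ D) ≡ 1 ∷ multiplicity D
multiplicity-use₀ D = cong (λ α → updateAt α Fin.zero suc) (multiplicity-skip₀ D)

skip₀-≤ᵥ : {D : Vec (Fin n) k} {a : ℕ} {P : Exp n} →
  multiplicity D ≤ᵥ P → multiplicity (skip₀ D) ≤ᵥ (a ∷ P)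
skip₀-≤ᵥ {D = D} D≤P = subst (_≤ᵥ _) (sym (multiplicity-skip₀ D)) (z≤n ∷ D≤P)

use₀-≤ᵥ : {D : Vec (Fin n) k} {a : ℕ} {P : Exp n} →
  multiplicity D ≤ᵥ P → multiplicity (use₀ D) ≤ᵥ (suc a ∷ P)
use₀-≤ᵥ {D = D} D≤P = subst (_≤ᵥ _) (sym (multiplicity-use₀ D)) (s≤s z≤n ∷ D≤P)

skip₀-≢ᵐ : {D D′ : Vec (Fin n) k} → D ≢ᵐ D′ → skip₀ D ≢ᵐ skip₀ D′
skip₀-≢ᵐ {D = D} {D′} D≢D′ e =
  D≢D′ (∷-injectiveʳ (trans (sym (multiplicity-skip₀ D)) (trans e (multiplicity-skip₀ D′))))

use₀-≢ᵐ : {D D′ : Vec (Fin n) k} → D ≢ᵐ D′ → use₀ D ≢ᵐ use₀ D′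
use₀-≢ᵐ {D = D} {D′} D≢D′ e =
  D≢D′ (∷-injectiveʳ (trans (sym (multiplicity-use₀ D)) (trans e (multiplicity-use₀ D′))))

skip₀-≢ᵐ-use₀ : (D : Vec (Fin n) (suc k)) (D′ : Vec (Fin n) k) → skip₀ D ≢ᵐ use₀ D′
skip₀-≢ᵐ-use₀ D D′ e with ∷-injectiveˡ (trans (sym (multiplicity-skip₀ D)) (trans e (multiplicity-use₀ D′)))
... | ()

multilinear : Exp n → (k : ℕ) → List (Vec (Fin n) k)
multilinear P           zero    = [] ∷ []
multilinear []          (suc k) = []
multilinear (zero  ∷ P) (suc k) = map skip₀ (multilinear P (suc k))
multilinear (suc _ ∷ P) (suc k) =
  map skip₀ (multilinear P (suc k)) ++ map use₀ (multilinear P k)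

length-multilinear : (P : Exp n) (k : ℕ) → length (multilinear P k) ≡ sup P C k
length-multilinear P           zero    = refl
length-multilinear []          (suc k) = refl
length-multilinear (zero  ∷ P) (suc k) =
  trans (length-map skip₀ (multilinear P (suc k))) (length-multilinear P (suc k))
length-multilinear (suc _ ∷ P) (suc k) = begin
  length (map skip₀ (multilinear P (suc k)) ++ map use₀ (multilinear P k))
    ≡⟨ length-++ (map skip₀ (multilinear P (suc k))) ⟩
  length (map skip₀ (multilinear P (suc k))) + length (map use₀ (multilinear P k))
    ≡⟨ cong₂ _+_ (length-map skip₀ (multilinear P (suc k))) (length-map use₀ (multilinear P k)) ⟩
  length (multilinear P (suc k)) + length (multilinear P k)
    ≡⟨ cong₂ _+_ (length-multilinear P (suc k)) (length-multilinear P k) ⟩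
  sup P C suc k + sup P C k
    ≡⟨ +-comm (sup P C suc k) (sup P C k) ⟩
  sup P C k + sup P C suc k
    ≡⟨ nCk+nC[k+1]≡[n+1]C[k+1] (sup P) k ⟩
  suc (sup P) C suc k
    ∎
  where open ≡-Reasoning

multilinear-≤ᵥ : (P : Exp n) (k : ℕ) → All (λ D → multiplicity D ≤ᵥ P) (multilinear P k)
multilinear-≤ᵥ P           zero    = 0ᵥ≤ᵥ P ∷ []
multilinear-≤ᵥ []          (suc k) = []
multilinear-≤ᵥ (zero  ∷ P) (suc k) =
  All.map⁺ (All.map (λ {D} → skip₀-≤ᵥ {D = D}) (multilinear-≤ᵥ P (suc k)))
multilinear-≤ᵥ (suc _ ∷ P) (suc k) = All.++⁺
  (All.map⁺ (All.map (λ {D} → skip₀-≤ᵥ {D = D}) (multilinear-≤ᵥ P (suc k))))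
  (All.map⁺ (All.map (λ {D} → use₀-≤ᵥ {D = D}) (multilinear-≤ᵥ P k)))

multilinear-distinct : (P : Exp n) (k : ℕ) → AllPairs _≢ᵐ_ (multilinear P k)
multilinear-distinct P           zero    = [] ∷ []
multilinear-distinct []          (suc k) = []
multilinear-distinct (zero  ∷ P) (suc k) =
  AllPairs.map⁺ (AllPairs.map (λ {D} {D′} → skip₀-≢ᵐ {D = D} {D′}) (multilinear-distinct P (suc k)))
multilinear-distinct (suc _ ∷ P) (suc k) = AllPairs.++⁺
  (AllPairs.map⁺ (AllPairs.map (λ {D} {D′} → skip₀-≢ᵐ {D = D} {D′}) (multilinear-distinct P (suc k))))
  (AllPairs.map⁺ (AllPairs.map (λ {D} {D′} → use₀-≢ᵐ {D = D} {D′}) (multilinear-distinct P k)))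
  (All.map⁺ (All.tabulate λ {D} _ → All.map⁺ (All.tabulate λ {D′} _ → skip₀-≢ᵐ-use₀ D D′)))

module _ {M : List (Exp n)} {α : Exp n} where
  open DecMembership (≡-dec {A = ℕ} {n = n} _≟_) using (_∈?_)

  polyOf-∈ : α ∈ M → polyOf M α ≡ 1ℚ
  polyOf-∈ α∈M = cong (if_then 1ℚ else 0ℚ) (dec-true (α ∈? M) α∈M)

  polyOf-∉ : α ∉ M → polyOf M α ≡ 0ℚ
  polyOf-∉ α∉M = cong (if_then 1ℚ else 0ℚ) (dec-false (α ∈? M) α∉M)

Σℚ-zero : {r : ℕ} (c : Fin r → ℚ) → (∀ j → c j ≡ 0ℚ) → Σℚ c ≡ 0ℚ
Σℚ-zero {zero}  c c≡0 = refl
Σℚ-zero {suc r} c c≡0 =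
  trans (cong₂ _+ℚ_ (c≡0 Fin.zero) (Σℚ-zero (c ∘ Fin.suc) (c≡0 ∘ Fin.suc))) (ℚ.+-identityʳ 0ℚ)

triangular⇒linIndep : {n : ℕ} {A : Set} (poly : A → Poly n) (point : A → Exp n) (G : List A) →
  All (λ D → poly D (point D) ≡ 1ℚ) G → AllPairs (λ D D′ → poly D′ (point D) ≡ 0ℚ) G →
  LinIndep (λ j → poly (lookup G j))
triangular⇒linIndep     poly point []      _ _ _ _ ()
triangular⇒linIndep {n} poly point (D ∷ G) (diag ∷ diags) (below ∷ belows) c combination≡0 = c≡0
  where
  rest : Exp n → ℚ
  rest γ = Σℚ (λ j → c (Fin.suc j) *ℚ poly (lookup G j) γ)

  rest≡0-at-D : rest (point D) ≡ 0ℚ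
  rest≡0-at-D = Σℚ-zero _ λ j →
    trans (cong (c (Fin.suc j) *ℚ_) (All.lookup below (∈-lookup j))) (ℚ.*-zeroʳ (c (Fin.suc j)))

  c₀ : ℚ
  c₀ = c Fin.zero

  c₀≡0 : c₀ ≡ 0ℚ
  c₀≡0 = begin
    c₀                                        ≡⟨ sym (ℚ.*-identityʳ c₀) ⟩
    c₀ *ℚ 1ℚ                                  ≡⟨ cong (c₀ *ℚ_) (sym diag) ⟩
    c₀ *ℚ poly D (point D)                    ≡⟨ sym (ℚ.+-identityʳ _) ⟩
    c₀ *ℚ poly D (point D) +ℚ 0ℚ              ≡⟨ cong (c₀ *ℚ poly D (point D) +ℚ_) (sym rest≡0-at-D) ⟩
    c₀ *ℚ poly D (point D) +ℚ rest (point D)  ≡⟨ combination≡0 (point D) ⟩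
    0ℚ                                        ∎
    where open ≡-Reasoning

  rest≡0 : ∀ γ → rest γ ≡ 0ℚ
  rest≡0 γ = begin
    rest γ                                  ≡⟨ sym (ℚ.+-identityˡ (rest γ)) ⟩
    0ℚ +ℚ rest γ                            ≡⟨ cong (_+ℚ rest γ) (sym (ℚ.*-zeroˡ (poly D γ))) ⟩
    0ℚ *ℚ poly D γ +ℚ rest γ                ≡⟨ cong (λ x → x *ℚ poly D γ +ℚ rest γ) (sym c₀≡0) ⟩
    c₀ *ℚ poly D γ +ℚ rest γ                ≡⟨ combination≡0 γ ⟩
    0ℚ                                      ∎
    where open ≡-Reasoning

  c≡0 : ∀ j → c j ≡ 0ℚ
  c≡0 Fin.zero    = c₀≡0
  c≡0 (Fin.suc j) = triangular⇒linIndep poly point G diags belows (c ∘ Fin.suc) rest≡0 j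

∈-remove : {A : Set} {x y : A} (xs ys : List A) → y ∈ xs ++ x ∷ ys → y ≢ x → y ∈ xs ++ ys
∈-remove []       ys (here y≡x) y≢x = ⊥-elim (y≢x y≡x)
∈-remove []       ys (there y∈) _   = y∈
∈-remove (_ ∷ xs) ys (here y≡z) _   = here y≡z
∈-remove (_ ∷ xs) ys (there y∈) y≢x = there (∈-remove xs ys y∈ y≢x)

unique∧⊆⇒length≤ : {A : Set} (xs ys : List A) → AllPairs _≢_ xs → All (_∈ ys) xs → length xs ≤ length ys
unique∧⊆⇒length≤ []       ys _             _            = z≤n
unique∧⊆⇒length≤ (x ∷ xs) ys (x∉xs ∷ uniq) (x∈ys ∷ xs⊆ys) with ys₁ , ys₂ , refl ← ∈-∃++ x∈ys =
  ≤-trans (s≤s (unique∧⊆⇒length≤ xs (ys₁ ++ ys₂) uniq xs⊆ys₁++ys₂)) (≤-reflexive length-suc)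
  where
  xs⊆ys₁++ys₂ : All (_∈ ys₁ ++ ys₂) xs
  xs⊆ys₁++ys₂ = All.zipWith (λ (x≢z , z∈ys) → ∈-remove ys₁ ys₂ z∈ys (x≢z ∘ sym)) (x∉xs , xs⊆ys)
  length-suc : suc (length (ys₁ ++ ys₂)) ≡ length (ys₁ ++ x ∷ ys₂)
  length-suc = begin
    suc (length (ys₁ ++ ys₂))            ≡⟨ cong suc (length-++ ys₁) ⟩
    suc (length ys₁ + length ys₂)        ≡⟨ sym (+-suc (length ys₁) (length ys₂)) ⟩
    length ys₁ + length (x ∷ ys₂)        ≡⟨ sym (length-++ ys₁) ⟩
    length (ys₁ ++ x ∷ ys₂)              ∎
    where open ≡-Reasoning

length-filter+length-filter¬ : {A : Set} {P : A → Set} (P? : Decidable P) (xs : List A) →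
  length (filter P? xs) + length (filter (¬? ∘ P?) xs) ≡ length xs
length-filter+length-filter¬ P? []       = refl
length-filter+length-filter¬ P? (x ∷ xs) with P? x
... | yes _ = cong suc (length-filter+length-filter¬ P? xs)
... | no  _ = trans (+-suc _ _) (cong suc (length-filter+length-filter¬ P? xs))

sum-map-≤ : {A : Set} (g : A → ℕ) {b : ℕ} {xs : List A} → All (λ x → g x ≤ b) xs →
  sum (map g xs) ≤ length xs * b
sum-map-≤ g []            = z≤n
sum-map-≤ g (gx≤b ∷ gxs≤b) = +-mono-≤ gx≤b (sum-map-≤ g gxs≤b)

module GreedySelection {A B : Set} (_≟_ : DecidableEquality B) (M : List B) (img : A → A → B) where
  open DecMembership _≟_ using (_∈?_)

  Hits : A → A → Set
  Hits D D′ = img D D′ ∈ M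

  hits? : (D : A) → Decidable (Hits D)
  hits? D D′ = img D D′ ∈? M

  misses? : (D : A) → Decidable (λ D′ → ¬ Hits D D′)
  misses? D = ¬? ∘ hits? D

  Separated : A → A → Set
  Separated D₁ D₂ = ∀ D → img D D₁ ≢ img D D₂

  length-hits< : (D : A) (xs : List A) → Hits D D → All (Separated D) xs → AllPairs Separated xs →
    suc (length (filter (hits? D) xs)) ≤ length M
  length-hits< D xs D-hits D-sep seps = subst (_≤ length M) (cong suc (length-map (img D) hits))
    (unique∧⊆⇒length≤ (map (img D) (D ∷ hits)) M images-distinct images-∈M)
    where
    hits : List A
    hits = filter (hits? D) xs
    images-distinct : AllPairs _≢_ (map (img D) (D ∷ hits))
    images-distinct = AllPairs.map⁺ (AllPairs.map (λ {D₁} {D₂} sep → sep D)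
      (All.filter⁺ (hits? D) D-sep ∷ AllPairs.filter⁺ (hits? D) seps))
    images-∈M : All (_∈ M) (map (img D) (D ∷ hits))
    images-∈M = All.map⁺ (D-hits ∷ All.all-filter (hits? D) xs)

  TriangularSelection : List A → Set
  TriangularSelection xs = Σ (List A) λ G →
    All (_∈ xs) G × AllPairs (λ D D′ → ¬ Hits D D′) G × length xs ≤ length G * length M

  select : (xs : List A) → AllPairs Separated xs → All (λ D → Hits D D) xs → TriangularSelection xs
  select xs = go (length xs) xs ≤-refl
    where
    go : (fuel : ℕ) (xs : List A) → length xs ≤ fuel →
      AllPairs Separated xs → All (λ D → Hits D D) xs → TriangularSelection xs
    go _          []       _           _              _               = [] , [] , [] , z≤n
    go (suc fuel) (D ∷ xs) (s≤s |xs|≤) (D-sep ∷ seps) (D-hits ∷ hits)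
      with G , G⊆rest , G-tri , |rest|≤ ← go fuel (filter (misses? D) xs)
                                           (≤-trans (length-filter (misses? D) xs) |xs|≤)
                                           (AllPairs.filter⁺ (misses? D) seps) (All.filter⁺ (misses? D) hits) =
      D ∷ G , here refl ∷ All.map (there ∘ proj₁ ∘ ∈-filter⁻ (misses? D) {xs = xs}) G⊆rest
            , All.map (proj₂ ∘ ∈-filter⁻ (misses? D) {xs = xs}) G⊆rest ∷ G-tri
            , subst (_≤ length M + length G * length M) (cong suc (length-filter+length-filter¬ (hits? D) xs))
                (+-mono-≤ (length-hits< D xs D-hits D-sep seps) |rest|≤)

dimDerivs≥-monomial : (M : List (Exp n)) (P : Exp n) → P ∈ M → (k : ℕ) →
  Σ ℕ λ r → DimDerivs≥ n k (polyOf M) r × sup P C k ≤ r * length M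
dimDerivs≥-monomial {n} M P P∈M k = derivativesFrom (select candidates separated self-hits)
  where
  Q : Vec (Fin n) k → Exp n
  Q D = P ⊖ multiplicity D

  open GreedySelection (≡-dec _≟_) M (λ D D′ → Q D ⊕ multiplicity D′)

  candidates : List (Vec (Fin n) k)
  candidates = multilinear P k

  separated : AllPairs Separated candidates
  separated = AllPairs.map (λ {D₁} {D₂} D₁≢D₂ D → D₁≢D₂ ∘ ⊕-cancelˡ (Q D) _ _) (multilinear-distinct P k)

  self-hits : All (λ D → Hits D D) candidates
  self-hits = All.map (λ D≤P → subst (_∈ M) (sym (⊖-⊕-cancel D≤P)) P∈M) (multilinear-≤ᵥ P k)

  derivativesFrom : TriangularSelection candidates →
    Σ ℕ λ r → DimDerivs≥ n k (polyOf M) r × sup P C k ≤ r * length M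
  derivativesFrom (G , G⊆candidates , G-tri , |candidates|≤) =
    length G , (lookup G , triangular⇒linIndep (λ D → ∂seq D (polyOf M)) Q G diag below) ,
    subst (_≤ length G * length M) (length-multilinear P k) |candidates|≤
    where
    diag : All (λ D → ∂seq D (polyOf M) (Q D) ≡ 1ℚ) G
    diag = All.map (λ {D} D∈candidates →
      trans (∂seq-shift D (polyOf M) (Q D)) (polyOf-∈ (All.lookup self-hits D∈candidates))) G⊆candidates

    below : AllPairs (λ D D′ → ∂seq D′ (polyOf M) (Q D) ≡ 0ℚ) G
    below = AllPairs.map (λ {D} {D′} miss → trans (∂seq-shift D′ (polyOf M) (Q D)) (polyOf-∉ miss)) G-tri

theorem2 : (n : ℕ) (M : List (Exp n)) → Unique M → M ≢ [] → (k : ℕ) →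
    Σ ℕ λ r → DimDerivs≥ n k (polyOf M) r
      × sum (map (λ P → sup P C k) M) ≤ r * (length M * length M)
theorem2 n []       _ []≢[] k = ⊥-elim ([]≢[] refl)
theorem2 n (P ∷ Ms) _ _     k = bound (dimDerivs≥-monomial (P ∷ Ms) P₀ P₀∈M k)
  where
  m : ℕ
  m = suc (length Ms)
  weight : Exp n → ℕ
  weight Q = sup Q C k
  P₀ : Exp n
  P₀ = argmax weight P Ms
  P₀∈M : P₀ ∈ P ∷ Ms
  P₀∈M = argmax-all weight (here refl) (All.tabulate there)
  maximal : All (λ Q → weight Q ≤ weight P₀) (P ∷ Ms)
  maximal = f[⊥]≤f[argmax] {f = weight} P Ms ∷ f[xs]≤f[argmax] {f = weight} P Ms
  bound : Σ ℕ (λ r → DimDerivs≥ n k (polyOf (P ∷ Ms)) r × weight P₀ ≤ r * m) →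
    Σ ℕ λ r → DimDerivs≥ n k (polyOf (P ∷ Ms)) r × sum (map weight (P ∷ Ms)) ≤ r * (m * m)
  bound (r , independent , P₀≤) = r , independent , (begin
    sum (map weight (P ∷ Ms))       ≤⟨ sum-map-≤ weight maximal ⟩
    m * weight P₀                   ≤⟨ *-monoʳ-≤ m P₀≤ ⟩
    m * (r * m)                     ≡⟨ sym (*-assoc m r m) ⟩
    m * r * m                       ≡⟨ cong (_* m) (*-comm m r) ⟩
    r * m * m                       ≡⟨ *-assoc r m m ⟩
    r * (m * m)                     ∎)
    where open ≤-Reasoning
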